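{- Let $n\ge3$ be an odd integer. A strong cardioidal starter of order $n$ exists if and only if $n\in\overline{C_2\setminus\{3\}}$, i.e. $n$ is a product of one or more (not necessarily distinct) primes from $C_2$ none of which equals $3$.
   Context: $C_2$ is the set of (odd) primes $p$ such that the multiplicative order of $2$ modulo $p$ is $\equiv2\pmod4$; for a set of primes $Y$, $\overline{Y}$ is the set of all products of one or more (not necessarily distinct) primes from $Y$. A starter of order $n$ ($n$ odd) is a partition of $\mathbb{Z}_n\setminus\{0\}$ into $(n-1)/2$ pairs $\{s_i,t_i\}$ such that the elements $\pm(s_i-t_i)$ are exactly the non-zero elements of $\mathbb{Z}_n$; it is strong if the sums $s_i+t_i$ are non-zero and pairwise distinct. A starter is cardioidal if every pair has the form $\{i,2i\bmod n\}$ for some $i\in\mathbb{Z}_n\setminus\{0\}$. -}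

module Defs where

open import Data.Nat using (ℕ; zero; suc; _+_; _*_; _∸_; _^_; _<_; _≤_; NonZero)
open import Data.Nat.DivMod using (_%_)
open import Data.Nat.Primality using (Prime)
open import Data.Product using (_×_; _,_; ∃-syntax)
open import Data.Sum using (_⊎_)
open import Data.List using (List; []; _∷_; map; concatMap; applyUpTo)
open import Data.Nat.ListAction using (product)
open import Data.List.Relation.Unary.All using (All)
open import Data.List.Relation.Unary.Unique.Propositional using (Unique)
open import Data.List.Relation.Binary.Permutation.Propositional using (_↭_)
open import Relation.Binary.PropositionalEquality using (_≡_; _≢_)

IsOrderOf2 : (p : ℕ) .{{_ : NonZero p}} → ℕ → Set
IsOrderOf2 p k =
  (0 < k) × ((2 ^ k) % p ≡ 1) × (∀ j → 0 < j → j < k → (2 ^ j) % p ≢ 1)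

-- C₂ : odd primes p such that ord_p(2) ≡ 2 (mod 4).
-- (Primes are non-zero, so p is written as suc m to supply NonZero p.)
C₂ : ℕ → Set
C₂ zero = Prime zero  -- uninhabited: 0 is not prime
C₂ (suc m) = Prime (suc m) × (suc m % 2 ≡ 1)
             × ∃[ k ] (IsOrderOf2 (suc m) k × (k % 4 ≡ 2))

C₂∖3 : ℕ → Set
C₂∖3 p = C₂ p × (p ≢ 3)

Closure : (ℕ → Set) → ℕ → Set
Closure Y n = ∃[ ps ] ((ps ≢ []) × All Y ps × (product ps ≡ n))

module _ (n : ℕ) .{{_ : NonZero n}} where

  -- Arithmetic in ℤ_n on representatives 0..n-1.
  subₙ : ℕ → ℕ → ℕ
  subₙ s t = (s + (n ∸ t)) % n

  addₙ : ℕ → ℕ → ℕ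
  addₙ s t = (s + t) % n

  nonzeroₙ : List ℕ
  nonzeroₙ = applyUpTo suc (n ∸ 1)

  -- A starter of order n, given as a list of pairs (s_i , t_i):
  -- the entries partition ℤ_n ∖ {0}, and the differences ±(s_i - t_i)
  -- are exactly the non-zero elements of ℤ_n.
  IsStarter : List (ℕ × ℕ) → Set
  IsStarter ps =
    (concatMap (λ { (s , t) → s ∷ t ∷ [] }) ps ↭ nonzeroₙ)
    × (concatMap (λ { (s , t) → subₙ s t ∷ subₙ t s ∷ [] }) ps ↭ nonzeroₙ)

  IsStrongStarter : List (ℕ × ℕ) → Set
  IsStrongStarter ps =
    IsStarter ps
    × All (λ { (s , t) → addₙ s t ≢ 0 }) ps
    × Unique (map (λ { (s , t) → addₙ s t }) ps)

  IsCardioidal : List (ℕ × ℕ) → Set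
  IsCardioidal ps =
    All (λ { (s , t) → (t ≡ (2 * s) % n) ⊎ (s ≡ (2 * t) % n) }) ps

  StrongCardioidalStarterExists : Set
  StrongCardioidalStarterExists =
    ∃[ ps ] (IsStrongStarter ps × IsCardioidal ps)

-- A strong cardioidal starter consists of pairs {i, 2i}; collecting the elements i into a
-- list I, both I, 2I and I, −I partition ℤₙ ∖ {0}, so membership in I is a 2-colouring of
-- ℤₙ ∖ {0} flipped by doubling and by negation. For a prime p ∣ n with n = m p and k the
-- order of 2 mod p, 2ᵏ m = m forces k = 2l to be even; then p ∣ 2ˡ + 1, so 2ˡ m = −m forces
-- l to be odd, and k ≡ 2 (mod 4). As the pair {i, 2i} has sum 3i ≠ 0, 3 ∤ n.
--
-- Conversely each p ∈ C₂ divides 2ˡ + 1 for l = ord_p 2 / 2 odd, and N ∣ x + 1, q ∣ N give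
-- N q ∣ x^q + 1, so n ∣ 2ʲ + 1 for some odd j. Colour x by the parity of the number of
-- t < j with 2ᵗ x in the upper half (n/2, n): as 2ʲ x = −x and exactly one of x, −x is in
-- the upper half, doubling flips this colour, and so does negation since j is odd. The pairs
-- {x, 2x} over one colour class form the starter; their sums 3x are distinct and non-zero
-- because 3 ∤ n.

module Submission where

open import Defs
open import Data.Nat using (ℕ; _≤_; NonZero)
open import Data.Nat.DivMod using (_%_)
open import Data.Product using (_×_)
open import Function.Bundles using (_⇔_)
open import Relation.Binary.PropositionalEquality using (_≡_)

open import Data.Bool.Base using (Bool; true; false; not; _xor_)
import Data.Bool.Properties as Bool
open import Data.Empty using (⊥-elim)
open import Data.Fin.Base using (toℕ; fromℕ<)
open import Data.Fin.Properties using (pigeonhole; toℕ-fromℕ<)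
open import Data.List.Base using (List; []; _∷_; _++_; map; concatMap; filter)
open import Data.List.Properties using (concatMap-map; map-id; map-∘; map-cong-local; map-id-local)
open import Data.List.Membership.Propositional using (_∈_; _∉_)
open import Data.List.Membership.Propositional.Properties
  using (∈-map⁺; ∈-map⁻; ∈-++⁺ˡ; ∈-++⁺ʳ; ∈-++⁻; ∈-filter⁺; ∈-filter⁻; ∈-applyUpTo⁺; ∈-applyUpTo⁻)
open import Data.List.Membership.Propositional.Properties.WithK using (unique∧set⇒bag)
open import Data.List.Relation.Binary.BagAndSetEquality using (∼bag⇒↭)
open import Data.List.Relation.Binary.Disjoint.Propositional using (Disjoint)
open import Data.List.Relation.Binary.Permutation.Propositional
  using (_↭_; ↭-refl; ↭-sym; ↭-trans; ↭-prep; ↭-swap; ↭⇒↭ₛ; module PermutationReasoning)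
open import Data.List.Relation.Binary.Permutation.Propositional.Properties using (∈-resp-↭; shift; ++-comm)
import Data.List.Relation.Binary.Permutation.Setoid.Properties as ↭ₛ
open import Data.List.Relation.Unary.All as All using (All; []; _∷_)
import Data.List.Relation.Unary.All.Properties as All
open import Data.List.Relation.Unary.Any using (here; there)
open import Data.List.Relation.Unary.Unique.Propositional using (Unique; []; _∷_)
import Data.List.Relation.Unary.Unique.Propositional.Properties as Unique
open import Data.Nat.Base
open import Data.Nat.Properties
open import Data.Nat.DivMod
open import Data.Nat.Divisibility
open import Data.Nat.Coprimality using (Coprime; coprime-divisor)
open import Data.Nat.GeneralisedArithmetic using (iterate)
open import Data.Nat.Induction using (<-rec)
open import Data.Nat.ListAction using (product)
open import Data.Nat.ListAction.Properties using (∈⇒∣product)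
open import Data.Nat.Primality
  using (Prime; prime?; prime[2]; euclidsLemma; prime⇒nonTrivial; prime⇒nonZero; prime⇒irreducible)
open import Data.Nat.Primality.Factorisation using (factorise; PrimeFactorisation)
open import Data.Nat.Tactic.RingSolver using (solve-∀)
open import Data.Product using (_,_; ∃-syntax; proj₁; proj₂; curry; swap)
open import Data.Sum using (_⊎_; inj₁; inj₂; [_,_]′)
open import Function.Base using (id; _∘_)
open import Function.Bundles using (mk⇔)
open import Level using (0ℓ)
open import Relation.Binary.Bundles using (Setoid)
open import Relation.Binary.Definitions using (DecidableEquality)
open import Relation.Binary.PropositionalEquality
open import Relation.Binary.Structures using (IsEquivalence)
open import Relation.Nullary using (¬_; Dec; does; yes; no)
open import Relation.Nullary.Decidable using (_×-dec_; from-yes)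
open import Relation.Nullary.Reflects using (ofʸ; ofⁿ)
open import Relation.Unary using (Decidable)

private variable
  A B : Set

prime[3] : Prime 3
prime[3] = from-yes (prime? 3)

prime⇒1< : ∀ {p} → Prime p → 1 < p
prime⇒1< {p} pr = nonTrivial⇒n>1 p {{prime⇒nonTrivial pr}}

prime∤⇒coprime : ∀ {p n} → Prime p → ¬ p ∣ n → Coprime n p
prime∤⇒coprime p-prime p∤n (d∣n , d∣p) with prime⇒irreducible p-prime d∣p
... | inj₁ d≡1 = d≡1
... | inj₂ refl = ⊥-elim (p∤n d∣n)

-- Congruences modulo M

module Congruence (M : ℕ) .{{_ : NonZero M}} where

  infix 4 _≈_
  record _≈_ (a b : ℕ) : Set where
    constructor mk≈
    field %-≡ : a % M ≡ b % M
  open _≈_ public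

  ≈-isEquivalence : IsEquivalence _≈_
  ≈-isEquivalence = record
    { refl = mk≈ refl
    ; sym = λ (mk≈ p) → mk≈ (sym p)
    ; trans = λ (mk≈ p) (mk≈ q) → mk≈ (trans p q)
    }

  ≈-setoid : Setoid 0ℓ 0ℓ
  ≈-setoid = record { isEquivalence = ≈-isEquivalence }

  open IsEquivalence ≈-isEquivalence public
    using () renaming (refl to ≈-refl; sym to ≈-sym; trans to ≈-trans; reflexive to ≡⇒≈)

  +-cong : ∀ {a b c d} → a ≈ b → c ≈ d → a + c ≈ b + d
  +-cong {a} {b} {c} {d} (mk≈ p) (mk≈ q) = mk≈ (begin
    (a + c) % M               ≡⟨ %-distribˡ-+ a c M ⟩
    (a % M + c % M) % M       ≡⟨ cong₂ (λ u v → (u + v) % M) p q ⟩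
    (b % M + d % M) % M       ≡⟨ %-distribˡ-+ b d M ⟨
    (b + d) % M               ∎)
    where open ≡-Reasoning

  *-cong : ∀ {a b c d} → a ≈ b → c ≈ d → a * c ≈ b * d
  *-cong {a} {b} {c} {d} (mk≈ p) (mk≈ q) = mk≈ (begin
    (a * c) % M               ≡⟨ %-distribˡ-* a c M ⟩
    (a % M * (c % M)) % M     ≡⟨ cong₂ (λ u v → (u * v) % M) p q ⟩
    (b % M * (d % M)) % M     ≡⟨ %-distribˡ-* b d M ⟨
    (b * d) % M               ∎)
    where open ≡-Reasoning

  +-congˡ : ∀ a {b c} → b ≈ c → a + b ≈ a + c
  +-congˡ a = +-cong (≈-refl {a})

  *-congˡ : ∀ a {b c} → b ≈ c → a * b ≈ a * c
  *-congˡ a = *-cong (≈-refl {a})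

  m%M≈m : ∀ a → a % M ≈ a
  m%M≈m a = mk≈ (m%n%n≡m%n a M)

  ≈⇒%≡ : ∀ {a b} → b < M → a ≈ b → a % M ≡ b
  ≈⇒%≡ b<M (mk≈ p) = trans p (m<n⇒m%n≡m b<M)

  ≈⇒≡ : ∀ {a b} → a < M → b < M → a ≈ b → a ≡ b
  ≈⇒≡ a<M b<M p = trans (sym (m<n⇒m%n≡m a<M)) (≈⇒%≡ b<M p)

  ∣⇒≈0 : ∀ {a} → M ∣ a → a ≈ 0
  ∣⇒≈0 {a} M∣a = mk≈ (trans (n∣m⇒m%n≡0 a M M∣a) (sym (m<n⇒m%n≡m (>-nonZero⁻¹ M))))

  ≈0⇒∣ : ∀ {a} → a ≈ 0 → M ∣ a
  ≈0⇒∣ {a} p = m%n≡0⇒n∣m a M (≈⇒%≡ (>-nonZero⁻¹ M) p)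

  m+k*M≈m : ∀ a k → a + k * M ≈ a
  m+k*M≈m a k = ≈-trans (+-congˡ a (∣⇒≈0 (n∣m*n k))) (≡⇒≈ (+-identityʳ a))

  m+[M∸m%M]≈0 : ∀ a → a + (M ∸ a % M) ≈ 0
  m+[M∸m%M]≈0 a = ∣⇒≈0 (divides (suc (a / M)) (begin
    a + (M ∸ a % M)                   ≡⟨ cong (_+ (M ∸ a % M)) (m≡m%n+[m/n]*n a M) ⟩
    a % M + a / M * M + (M ∸ a % M)   ≡⟨ rearrange (a % M) (a / M * M) (M ∸ a % M) ⟩
    a / M * M + (a % M + (M ∸ a % M)) ≡⟨ cong (a / M * M +_) (m+[n∸m]≡n (m%n≤n a M)) ⟩
    a / M * M + M                     ≡⟨ +-comm (a / M * M) M ⟩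
    suc (a / M) * M                   ∎))
    where
    open ≡-Reasoning
    rearrange : ∀ r q s → r + q + s ≡ q + (r + s)
    rearrange = solve-∀

  +-cancelʳ-≈ : ∀ {a b} c → a + c ≈ b + c → a ≈ b
  +-cancelʳ-≈ {a} {b} c p = begin
    a                     ≡⟨ +-identityʳ a ⟨
    a + 0                 ≈⟨ +-congˡ a (m+[M∸m%M]≈0 c) ⟨
    a + (c + c')          ≡⟨ +-assoc a c c' ⟨
    a + c + c'            ≈⟨ +-cong p ≈-refl ⟩
    b + c + c'            ≡⟨ +-assoc b c c' ⟩
    b + (c + c')          ≈⟨ +-congˡ b (m+[M∸m%M]≈0 c) ⟩
    b + 0                 ≡⟨ +-identityʳ b ⟩
    b                     ∎
    where
    c' = M ∸ c % M
    open import Relation.Binary.Reasoning.Setoid ≈-setoid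

  +-cancel-≈0 : ∀ {a b c} → b ≈ 0 → a + b ≈ c → a ≈ c
  +-cancel-≈0 {a} {b} {c} b≈0 p =
    +-cancelʳ-≈ b (≈-trans p (≈-sym (≈-trans (+-congˡ c b≈0) (≡⇒≈ (+-identityʳ c)))))

  *-cancelˡ-≈-coprime : ∀ {c} → Coprime M c → ∀ {a b} → c * a ≈ c * b → a ≈ b
  *-cancelˡ-≈-coprime {c} cop {a} {b} ca≈cb =
    [ (λ a≤b → ≈-sym (cancel-≤ a≤b ca≈cb)) , (λ b≤a → cancel-≤ b≤a (≈-sym ca≈cb)) ]′ (≤-total a b)
    where
    cancel-≤ : ∀ {a b} → a ≤ b → c * a ≈ c * b → b ≈ a
    cancel-≤ {a} {b} a≤b ca≈cb = begin
      b               ≡⟨ m∸n+n≡m a≤b ⟨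
      b ∸ a + a       ≈⟨ +-cong (∣⇒≈0 (coprime-divisor cop (≈0⇒∣ c[b∸a]≈0))) ≈-refl ⟩
      a               ∎
      where
      open import Relation.Binary.Reasoning.Setoid ≈-setoid
      c[b∸a]≈0 : c * (b ∸ a) ≈ 0
      c[b∸a]≈0 = +-cancelʳ-≈ (c * a) (begin
        c * (b ∸ a) + c * a   ≡⟨ *-distribˡ-+ c (b ∸ a) a ⟨
        c * (b ∸ a + a)       ≡⟨ cong (c *_) (m∸n+n≡m a≤b) ⟩
        c * b                 ≈⟨ ca≈cb ⟨
        c * a                 ∎)

  module _ (M-odd : M % 2 ≡ 1) where

    [1+M/2]*2≈1 : suc (M / 2) * 2 ≈ 1
    [1+M/2]*2≈1 = ≈-trans (≡⇒≈ (begin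
      suc h * 2          ≡⟨ shuffle h ⟩
      h * 2 + 1 + 1      ≡⟨ cong (λ r → h * 2 + r + 1) M-odd ⟨
      h * 2 + M % 2 + 1  ≡⟨ cong (_+ 1) (+-comm (h * 2) (M % 2)) ⟩
      M % 2 + h * 2 + 1  ≡⟨ cong (_+ 1) (m≡m%n+[m/n]*n M 2) ⟨
      M + 1              ≡⟨ +-comm M 1 ⟩
      1 + M              ≡⟨ cong (1 +_) (*-identityˡ M) ⟨
      1 + 1 * M          ∎)) (m+k*M≈m 1 1)
      where
      h = M / 2
      open ≡-Reasoning
      shuffle : ∀ h → suc h * 2 ≡ h * 2 + 1 + 1
      shuffle = solve-∀

    *-cancelˡ-≈-2 : ∀ {a b} → 2 * a ≈ 2 * b → a ≈ b
    *-cancelˡ-≈-2 = *-cancelˡ-≈-coprime (prime∤⇒coprime prime[2] 2∤M)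
      where
      2∤M : ¬ 2 ∣ M
      2∤M 2∣M = 0≢1+n (trans (sym (n∣m⇒m%n≡0 M 2 2∣M)) M-odd)

    *-cancelˡ-≈-2^ : ∀ t {a b} → 2 ^ t * a ≈ 2 ^ t * b → a ≈ b
    *-cancelˡ-≈-2^ zero {a} {b} p =
      ≈-trans (≡⇒≈ (sym (+-identityʳ a))) (≈-trans p (≡⇒≈ (+-identityʳ b)))
    *-cancelˡ-≈-2^ (suc t) {a} {b} p = *-cancelˡ-≈-2^ t (*-cancelˡ-≈-2
      (≈-trans (≡⇒≈ (sym (*-assoc 2 (2 ^ t) a))) (≈-trans p (≡⇒≈ (*-assoc 2 (2 ^ t) b)))))

∣-resp-≈ : ∀ {M} .{{_ : NonZero M}} {a b d} → d ∣ M → Congruence._≈_ M a b → d ∣ b → d ∣ a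
∣-resp-≈ {M} {a} {b} d∣M (Congruence.mk≈ p) d∣b =
  ∣n∣m%n⇒∣m d∣M (subst (_ ∣_) (sym p) (%-presˡ-∣ d∣b d∣M))

-- Odd numbers

data Odd : ℕ → Set where
  1-odd  : Odd 1
  2+-odd : ∀ {n} → Odd n → Odd (2 + n)

odd⇒%2≡1 : ∀ {n} → Odd n → n % 2 ≡ 1
odd⇒%2≡1 1-odd = refl
odd⇒%2≡1 (2+-odd {n} o) = trans (%-remove-+ˡ n ∣-refl) (odd⇒%2≡1 o)

%2≡1⇒odd : ∀ n → n % 2 ≡ 1 → Odd n
%2≡1⇒odd 1 _ = 1-odd
%2≡1⇒odd (suc (suc n)) p = 2+-odd (%2≡1⇒odd n (trans (sym (%-remove-+ˡ n ∣-refl)) p))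

odd-* : ∀ {m n} → Odd m → Odd n → Odd (m * n)
odd-* {m} {n} om on = %2≡1⇒odd (m * n) (begin
  m * n % 2                 ≡⟨ %-distribˡ-* m n 2 ⟩
  (m % 2) * (n % 2) % 2     ≡⟨ cong₂ (λ u v → u * v % 2) (odd⇒%2≡1 om) (odd⇒%2≡1 on) ⟩
  1                         ∎)
  where open ≡-Reasoning

odd-1+2* : ∀ h → Odd (1 + 2 * h)
odd-1+2* zero = 1-odd
odd-1+2* (suc h) = subst Odd (cong suc (sym (*-suc 2 h))) (2+-odd (odd-1+2* h))

even-or-odd : ∀ t → ∃[ h ] t ≡ h + h ⊎ Odd t
even-or-odd zero = inj₁ (0 , refl)
even-or-odd (suc zero) = inj₂ 1-odd
even-or-odd (suc (suc t)) with even-or-odd t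
... | inj₁ (h , refl) = inj₁ (suc h , cong suc (sym (+-suc h h)))
... | inj₂ o = inj₂ (2+-odd o)

[odd+odd]%4≡2 : ∀ {l} → Odd l → (l + l) % 4 ≡ 2
[odd+odd]%4≡2 1-odd = refl
[odd+odd]%4≡2 (2+-odd {l} o) = trans (cong (_% 4) (regroup l)) (trans (%-remove-+ˡ (l + l) ∣-refl) ([odd+odd]%4≡2 o))
  where
  regroup : ∀ l → 2 + l + (2 + l) ≡ 4 + (l + l)
  regroup = solve-∀

∣-preserves-odd : ∀ {d n} → d ∣ n → n % 2 ≡ 1 → d % 2 ≡ 1
∣-preserves-odd {d} {n} d∣n n%2≡1 with d % 2 in eq | m%n<n d 2
... | 1 | _ = refl
... | 0 | _ = ⊥-elim (0≢1+n (trans (sym (n∣m⇒m%n≡0 n 2 (∣-trans (m%n≡0⇒n∣m d 2 eq) d∣n))) n%2≡1))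
... | suc (suc _) | s≤s (s≤s ())

-- Divisors of x ^ c + 1 for odd c

module _ (x : ℕ) where
  open Congruence (suc x * suc x)
  open import Relation.Binary.Reasoning.Setoid ≈-setoid

  x^odd+1≈odd*[x+1] : ∀ {c} → Odd c → x ^ c + 1 ≈ c * suc x
  x^odd+1≈odd*[x+1] 1-odd = ≡⇒≈ (base x)
    where
    base : ∀ x → x * 1 + 1 ≡ 1 * suc x
    base = solve-∀
  x^odd+1≈odd*[x+1] (2+-odd {c} o) = +-cancel-≈0 carry≈0 (begin
    x ^ (2 + c) + 1 + carry               ≡⟨ expand x (x ^ c) ⟩
    x ^ c + 1 + 2 * suc x + x ^ c * M     ≈⟨ m+k*M≈m (x ^ c + 1 + 2 * suc x) (x ^ c) ⟩
    x ^ c + 1 + 2 * suc x                 ≈⟨ +-cong (x^odd+1≈odd*[x+1] o) ≈-refl ⟩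
    c * suc x + 2 * suc x                 ≡⟨ *-distribʳ-+ (suc x) c 2 ⟨
    (c + 2) * suc x                       ≡⟨ cong (_* suc x) (+-comm c 2) ⟩
    (2 + c) * suc x                       ∎)
    where
    M = suc x * suc x
    -- Writing y = x + 1: x ^ (2 + c) + 1 + 2 y (x ^ c + 1) = (x ^ c + 1) + 2 y + x ^ c y², and
    -- y (x ^ c + 1) ≈ c y² ≈ 0 by induction.
    carry = 2 * (suc x * (x ^ c + 1))
    expand : ∀ x P → x * (x * P) + 1 + 2 * (suc x * (P + 1)) ≡ P + 1 + 2 * suc x + P * (suc x * suc x)
    expand = solve-∀
    carry≈0 : carry ≈ 0
    carry≈0 = begin
      2 * (suc x * (x ^ c + 1))   ≈⟨ *-congˡ 2 (*-congˡ (suc x) (x^odd+1≈odd*[x+1] o)) ⟩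
      2 * (suc x * (c * suc x))   ≡⟨ regroup (suc x) c ⟩
      0 + (2 * c) * M             ≈⟨ m+k*M≈m 0 (2 * c) ⟩
      0                           ∎
      where
      regroup : ∀ y c → 2 * (y * (c * y)) ≡ 0 + (2 * c) * (y * y)
      regroup = solve-∀

x+1∣x^odd+1 : ∀ x {c} → Odd c → x + 1 ∣ x ^ c + 1
x+1∣x^odd+1 x {c} o = subst (_∣ x ^ c + 1) (+-comm 1 x)
  (∣-resp-≈ (m∣m*n (suc x)) (x^odd+1≈odd*[x+1] x o) (n∣m*n c))

∣x+1⇒*∣x^odd+1 : ∀ {N x q} → N ∣ x + 1 → q ∣ N → Odd q → N * q ∣ x ^ q + 1
∣x+1⇒*∣x^odd+1 {N} {x} {q} N∣x+1 q∣N oq =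
  ∣-resp-≈ (∣-trans (*-monoʳ-∣ N q∣N) (*-pres-∣ N∣1+x N∣1+x)) (x^odd+1≈odd*[x+1] x oq)
    (subst (N * q ∣_) (*-comm (suc x) q) (*-monoˡ-∣ q N∣1+x))
  where
  N∣1+x : N ∣ suc x
  N∣1+x = subst (N ∣_) (+-comm x 1) N∣x+1

prime∤∧∣∧∣⇒*∣ : ∀ {p n m} → Prime p → ¬ p ∣ n → p ∣ m → n ∣ m → p * n ∣ m
prime∤∧∣∧∣⇒*∣ {p} {n} pr p∤n p∣m (divides k refl) with euclidsLemma k n pr p∣m
... | inj₂ p∣n = ⊥-elim (p∤n p∣n)
... | inj₁ (divides k′ refl) = divides k′ (*-assoc k′ p n)

-- The multiplicative order of 2

least-witness : ∀ {P : ℕ → Set} → Decidable P → ∀ n → P n → ∃[ k ] (P k × (∀ j → j < k → ¬ P j))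
least-witness {P} P? = <-rec _ search
  where
  search : ∀ n → (∀ {m} → m < n → P m → ∃[ k ] (P k × (∀ j → j < k → ¬ P j))) → P n →
           ∃[ k ] (P k × (∀ j → j < k → ¬ P j))
  search n smaller Pn with anyUpTo? P? n
  ... | yes (m , m<n , Pm) = smaller m<n Pm
  ... | no none = n , Pn , λ j j<n Pj → none (j , j<n , Pj)

module _ {p} .{{_ : NonZero p}} (1<p : 1 < p) where
  open Congruence p

  1%p≡1 : 1 % p ≡ 1
  1%p≡1 = m<n⇒m%n≡m 1<p

  order-of-2-exists : p % 2 ≡ 1 → ∃[ k ] IsOrderOf2 p k
  order-of-2-exists p-odd with least-witness (λ j → (0 <? j) ×-dec (2 ^ j % p ≟ 1)) t (0<t , 2^t%p≡1)
    where
    residue = λ i → fromℕ< (m%n<n (2 ^ toℕ i) p)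
    collision = pigeonhole (n<1+n p) residue
    i = toℕ (proj₁ collision)
    j = toℕ (proj₁ (proj₂ collision))
    i<j : i < j
    i<j = proj₁ (proj₂ (proj₂ collision))
    2^i≈2^j : 2 ^ i ≈ 2 ^ j
    2^i≈2^j = mk≈ (trans (sym (toℕ-fromℕ< _))
      (trans (cong toℕ (proj₂ (proj₂ (proj₂ collision)))) (toℕ-fromℕ< _)))
    t = j ∸ i
    0<t : 0 < t
    0<t = m<n⇒0<n∸m i<j
    2^t%p≡1 : 2 ^ t % p ≡ 1
    2^t%p≡1 = trans (sym (%-≡ (*-cancelˡ-≈-2^ p-odd i (begin
      2 ^ i * 1      ≡⟨ *-identityʳ (2 ^ i) ⟩
      2 ^ i          ≈⟨ 2^i≈2^j ⟩
      2 ^ j          ≡⟨ cong (2 ^_) (m+[n∸m]≡n (<⇒≤ i<j)) ⟨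
      2 ^ (i + t)    ≡⟨ ^-distribˡ-+-* 2 i t ⟩
      2 ^ i * 2 ^ t  ∎)))) 1%p≡1
      where open import Relation.Binary.Reasoning.Setoid ≈-setoid
  ... | k , (0<k , 2^k%p≡1) , below = k , 0<k , 2^k%p≡1 , λ j 0<j j<k → curry (below j j<k) 0<j

module _ {p} .{{_ : NonZero p}} (pr : Prime p) where
  open Congruence p

  x²≈1∧x≉1⇒p∣x+1 : ∀ x → x * x ≈ 1 → ¬ x ≈ 1 → p ∣ x + 1
  x²≈1∧x≉1⇒p∣x+1 zero 0≈1 _
    with () ← trans (sym (m<n⇒m%n≡m (>-nonZero⁻¹ p))) (trans (%-≡ 0≈1) (1%p≡1 (prime⇒1< pr)))
  x²≈1∧x≉1⇒p∣x+1 (suc y) x²≈1 x≉1 with euclidsLemma y (suc y + 1) pr (≈0⇒∣ (+-cancelʳ-≈ 1 (begin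
      y * (suc y + 1) + 1   ≡⟨ square y ⟨
      suc y * suc y         ≈⟨ x²≈1 ⟩
      1                     ∎)))
    where
    open import Relation.Binary.Reasoning.Setoid ≈-setoid
    square : ∀ y → suc y * suc y ≡ y * (suc y + 1) + 1
    square = solve-∀
  ... | inj₁ p∣y = ⊥-elim (x≉1 (+-congˡ 1 (∣⇒≈0 p∣y)))
  ... | inj₂ p∣x+1 = p∣x+1

  order-of-2-even⇒∣2^half+1 : ∀ {l} → IsOrderOf2 p (l + l) → p ∣ 2 ^ l + 1
  order-of-2-even⇒∣2^half+1 {zero} (() , _)
  order-of-2-even⇒∣2^half+1 {l@(suc _)} (_ , 2^[l+l]%p≡1 , minimal) =
    x²≈1∧x≉1⇒p∣x+1 (2 ^ l) [2^l]²≈1 2^l≉1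
    where
    [2^l]²≈1 : 2 ^ l * 2 ^ l ≈ 1
    [2^l]²≈1 = mk≈ (begin
      2 ^ l * 2 ^ l % p   ≡⟨ cong (_% p) (^-distribˡ-+-* 2 l l) ⟨
      2 ^ (l + l) % p     ≡⟨ 2^[l+l]%p≡1 ⟩
      1                   ≡⟨ 1%p≡1 (prime⇒1< pr) ⟨
      1 % p               ∎)
      where open ≡-Reasoning
    2^l≉1 : ¬ 2 ^ l ≈ 1
    2^l≉1 2^l≈1 = minimal l z<s (m<m+n l z<s) (≈⇒%≡ (prime⇒1< pr) 2^l≈1)

  order≡2[mod4]⇒∣2^odd+1 : ∀ {k} → IsOrderOf2 p k → k % 4 ≡ 2 → ∃[ l ] (Odd l × p ∣ 2 ^ l + 1)
  order≡2[mod4]⇒∣2^odd+1 {k} order k%4≡2 =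
    l , odd-1+2* (k / 4) , order-of-2-even⇒∣2^half+1 (subst (IsOrderOf2 p) k≡l+l order)
    where
    l = 1 + 2 * (k / 4)
    k≡l+l : k ≡ l + l
    k≡l+l = trans (m≡m%n+[m/n]*n k 4) (trans (cong (_+ k / 4 * 4) k%4≡2) (halve (k / 4)))
      where
      halve : ∀ a → 2 + a * 4 ≡ (1 + 2 * a) + (1 + 2 * a)
      halve = solve-∀

-- Products of primes from C₂

C₂⇒prime : ∀ {p} → C₂ p → Prime p
C₂⇒prime {zero} pr = pr
C₂⇒prime {suc _} (pr , _) = pr

C₂⇒odd : ∀ {p} → C₂ p → Odd p
C₂⇒odd {zero} pr = ⊥-elim (≢-nonZero⁻¹ 0 {{prime⇒nonZero pr}} refl)
C₂⇒odd {suc m} (_ , p%2≡1 , _) = %2≡1⇒odd (suc m) p%2≡1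

C₂⇒∣2^odd+1 : ∀ {p} → C₂ p → ∃[ l ] (Odd l × p ∣ 2 ^ l + 1)
C₂⇒∣2^odd+1 {zero} pr = ⊥-elim (≢-nonZero⁻¹ 0 {{prime⇒nonZero pr}} refl)
C₂⇒∣2^odd+1 {suc _} (pr , _ , k , ord , k%4≡2) = order≡2[mod4]⇒∣2^odd+1 pr ord k%4≡2

product-C₂-∣2^odd+1 : ∀ {ps} → All C₂ ps → ∃[ j ] (Odd j × product ps ∣ 2 ^ j + 1)
product-C₂-∣2^odd+1 [] = 1 , 1-odd , divides 3 refl
product-C₂-∣2^odd+1 {q ∷ qs} (q∈C₂ ∷ qs⊆C₂) with product-C₂-∣2^odd+1 qs⊆C₂ | C₂⇒∣2^odd+1 q∈C₂
... | j , odd-j , N∣2^j+1 | l , odd-l , q∣2^l+1 with q ∣? product qs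
...   | yes q∣N = j * q , odd-* odd-j (C₂⇒odd q∈C₂) ,
        subst₂ _∣_ (*-comm (product qs) q) (cong (_+ 1) (^-*-assoc 2 j q))
          (∣x+1⇒*∣x^odd+1 N∣2^j+1 q∣N (C₂⇒odd q∈C₂))
...   | no q∤N = j * l , odd-* odd-j odd-l , prime∤∧∣∧∣⇒*∣ (C₂⇒prime q∈C₂) q∤N q∣2^jl+1 N∣2^jl+1
  where
  N∣2^jl+1 : product qs ∣ 2 ^ (j * l) + 1
  N∣2^jl+1 = subst (λ e → product qs ∣ e + 1) (^-*-assoc 2 j l)
    (∣-trans N∣2^j+1 (x+1∣x^odd+1 (2 ^ j) odd-l))
  q∣2^jl+1 : q ∣ 2 ^ (j * l) + 1
  q∣2^jl+1 = subst (λ e → q ∣ 2 ^ e + 1) (*-comm l j)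
    (subst (λ e → q ∣ e + 1) (^-*-assoc 2 l j) (∣-trans q∣2^l+1 (x+1∣x^odd+1 (2 ^ l) odd-j)))

prime∤product : ∀ {r ps} → Prime r → All (λ p → Prime p × p ≢ r) ps → ¬ r ∣ product ps
prime∤product r-prime [] r∣1 = <⇒≢ (prime⇒1< r-prime) (sym (∣1⇒≡1 r∣1))
prime∤product {r} {q ∷ qs} r-prime ((q-prime , q≢r) ∷ rest) r∣qN with euclidsLemma q (product qs) r-prime r∣qN
... | inj₂ r∣N = prime∤product r-prime rest r∣N
... | inj₁ r∣q with prime⇒irreducible q-prime r∣q
...   | inj₁ r≡1 = <⇒≢ (prime⇒1< r-prime) (sym r≡1)
...   | inj₂ r≡q = q≢r (sym r≡q)

closure⇒∣2^odd+1 : ∀ {n} → Closure C₂∖3 n → ∃[ j ] (Odd j × n ∣ 2 ^ j + 1)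
closure⇒∣2^odd+1 (ps , _ , ps⊆C₂∖3 , refl) = product-C₂-∣2^odd+1 (All.map proj₁ ps⊆C₂∖3)

closure⇒3∤ : ∀ {n} → Closure C₂∖3 n → ¬ 3 ∣ n
closure⇒3∤ (ps , _ , ps⊆C₂∖3 , refl) =
  prime∤product prime[3] (All.map (λ (c , ≢3) → C₂⇒prime c , ≢3) ps⊆C₂∖3)

prime-divisors⇒Closure : ∀ {Y : ℕ → Set} n .{{_ : NonZero n}} → 1 < n →
  (∀ {p} → Prime p → p ∣ n → Y p) → Closure Y n
prime-divisors⇒Closure n 1<n prime∣n⇒Y =
  factors , factors≢[] , All.tabulate (λ p∈ → prime∣n⇒Y (All.lookup factorsPrime p∈) (p∣n p∈)) ,
  sym isFactorisation
  where
  open PrimeFactorisation (factorise n)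
  factors≢[] : factors ≢ []
  factors≢[] factors≡[] = <⇒≢ 1<n (sym (trans isFactorisation (cong product factors≡[])))
  p∣n : ∀ {p} → p ∈ factors → p ∣ n
  p∣n p∈ = subst (_ ∣_) (sym isFactorisation) (∈⇒∣product p∈)

-- Permutations of duplicate-free lists

unique∧same-elements⇒↭ : {xs ys : List A} → Unique xs → Unique ys →
  (∀ {z} → z ∈ xs → z ∈ ys) → (∀ {z} → z ∈ ys → z ∈ xs) → xs ↭ ys
unique∧same-elements⇒↭ xs! ys! ⊆ ⊇ = ∼bag⇒↭ (unique∧set⇒bag xs! ys! (mk⇔ ⊆ ⊇))

Unique-++-disjoint : ∀ {xs ys : List A} → Unique (xs ++ ys) → Disjoint xs ys
Unique-++-disjoint {xs = x ∷ xs} (x≢ ∷ _) (here refl , v∈ys) = All.lookup x≢ (∈-++⁺ʳ xs v∈ys) refl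
Unique-++-disjoint {xs = x ∷ xs} (_ ∷ xs++ys!) (there v∈xs , v∈ys) = Unique-++-disjoint xs++ys! (v∈xs , v∈ys)

Unique-map⁺-local : ∀ {f : A → B} {xs} → (∀ {x y} → x ∈ xs → y ∈ xs → f x ≡ f y → x ≡ y) →
  Unique xs → Unique (map f xs)
Unique-map⁺-local {xs = []} _ [] = []
Unique-map⁺-local {f = f} {x ∷ xs} inj (x≢xs ∷ xs!) =
  All.tabulate fx≢ ∷ Unique-map⁺-local (λ x∈ y∈ → inj (there x∈) (there y∈)) xs!
  where
  fx≢ : ∀ {fy} → fy ∈ map f xs → f x ≢ fy
  fx≢ fy∈ fx≡fy with ∈-map⁻ f fy∈
  ... | y , y∈ , refl = All.lookup x≢xs y∈ (inj (here refl) (there y∈) fx≡fy)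

private
  ↭-prep₂ : ∀ (x y : B) {zs xs ys} → zs ↭ xs ++ ys → x ∷ y ∷ zs ↭ x ∷ xs ++ y ∷ ys
  ↭-prep₂ x y {xs = xs} {ys} p = ↭-prep x (↭-trans (↭-prep y p) (↭-sym (shift y xs ys)))

concatMap-pairs↭ : (k₁ k₂ : A → B) → ∀ as →
  concatMap (λ a → k₁ a ∷ k₂ a ∷ []) as ↭ map k₁ as ++ map k₂ as
concatMap-pairs↭ k₁ k₂ [] = ↭-refl
concatMap-pairs↭ k₁ k₂ (a ∷ as) = ↭-prep₂ (k₁ a) (k₂ a) (concatMap-pairs↭ k₁ k₂ as)

-- Two-colourings flipped by a map

module _ {P : A → Set} {g : A → A} (g-pres : ∀ {x} → P x → P (g x))
         (c : A → Bool) (c-flip : ∀ {x} → P x → c (g x) ≡ not (c x)) where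

  colour-iterate-odd : ∀ {t x} → Odd t → P x → c (iterate g x t) ≡ not (c x)
  colour-iterate-odd 1-odd Px = c-flip Px
  colour-iterate-odd {x = x} (2+-odd {t} o) Px = begin
    c (iterate g (g (g x)) t)   ≡⟨ colour-iterate-odd o (g-pres (g-pres Px)) ⟩
    not (c (g (g x)))           ≡⟨ cong not (colour-twice Px) ⟩
    not (c x)                   ∎
    where
    open ≡-Reasoning
    colour-twice : ∀ {x} → P x → c (g (g x)) ≡ c x
    colour-twice Px = trans (c-flip (g-pres Px)) (trans (cong not (c-flip Px)) (Bool.not-involutive _))

  colour-iterate-double : ∀ h {x} → P x → c (iterate g x (h + h)) ≡ c x
  colour-iterate-double zero Px = refl
  colour-iterate-double (suc h) {x} Px rewrite +-suc h h =
    trans (colour-iterate-double h (g-pres (g-pres Px)))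
          (trans (c-flip (g-pres Px)) (trans (cong not (c-flip Px)) (Bool.not-involutive (c x))))

  colour-fixed⇒even : ∀ {t x} → P x → c (iterate g x t) ≡ c x → ∃[ h ] t ≡ h + h
  colour-fixed⇒even {t} Px fixed with even-or-odd t
  ... | inj₁ even = even
  ... | inj₂ odd = ⊥-elim (Bool.not-¬ refl (trans (sym fixed) (colour-iterate-odd odd Px)))

  colour-flipped⇒odd : ∀ {t x} → P x → c (iterate g x t) ≡ not (c x) → Odd t
  colour-flipped⇒odd {t} {x} Px flipped with even-or-odd t
  ... | inj₂ odd = odd
  ... | inj₁ (h , refl) = ⊥-elim (Bool.not-¬ refl (trans (sym (colour-iterate-double h Px)) flipped))

uncoloured : (A → Bool) → List A → List A
uncoloured c = filter (λ x → c x Bool.≟ false)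

module _ (c : A → Bool) (zs : List A) {x} (x∈ : x ∈ uncoloured c zs) where

  uncoloured⊆ : x ∈ zs
  uncoloured⊆ = proj₁ (∈-filter⁻ (λ x → c x Bool.≟ false) {xs = zs} x∈)

  uncoloured-false : c x ≡ false
  uncoloured-false = proj₂ (∈-filter⁻ (λ x → c x Bool.≟ false) {xs = zs} x∈)

uncoloured-unique : ∀ (c : A → Bool) {zs} → Unique zs → Unique (uncoloured c zs)
uncoloured-unique c = Unique.filter⁺ (λ x → c x Bool.≟ false)

-- Splittings xs ++ map f xs ↭ zs correspond to 2-colourings of zs that f flips.
module Halves {f : A → A} {zs : List A} (zs! : Unique zs)
              (f-closed : ∀ {x} → x ∈ zs → f x ∈ zs)
              (f-injective : ∀ {x y} → x ∈ zs → y ∈ zs → f x ≡ f y → x ≡ y) where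

  module _ (_≟_ : DecidableEquality A) {xs} (split : xs ++ map f xs ↭ zs) where
    open import Data.List.Membership.DecPropositional _≟_ using (_∈?_)

    private
      split! : Unique (xs ++ map f xs)
      split! = ↭ₛ.Unique-resp-↭ (setoid A) (↭⇒↭ₛ (↭-sym split)) zs!

      xs⊆zs : ∀ {x} → x ∈ xs → x ∈ zs
      xs⊆zs x∈ = ∈-resp-↭ split (∈-++⁺ˡ x∈)

    ∈⇒f∉ : ∀ {x} → x ∈ xs → f x ∉ xs
    ∈⇒f∉ x∈ fx∈ = Unique-++-disjoint split! (fx∈ , ∈-map⁺ f x∈)

    ∉⇒f∈ : ∀ {x} → x ∈ zs → x ∉ xs → f x ∈ xs
    ∉⇒f∈ x∈zs x∉ with ∈-++⁻ xs (∈-resp-↭ (↭-sym split) (f-closed x∈zs))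
    ... | inj₁ fx∈ = fx∈
    ... | inj₂ fx∈fxs with ∈-map⁻ f fx∈fxs
    ...   | y , y∈ , fx≡fy = ⊥-elim (x∉ (subst (_∈ xs) (sym (f-injective x∈zs (xs⊆zs y∈) fx≡fy)) y∈))

    membership-flips : ∀ {x} → x ∈ zs → does (f x ∈? xs) ≡ not (does (x ∈? xs))
    membership-flips {x} x∈zs with x ∈? xs | f x ∈? xs
    ... | yes x∈ | yes fx∈ = ⊥-elim (∈⇒f∉ x∈ fx∈)
    ... | yes _  | no _    = refl
    ... | no _   | yes _   = refl
    ... | no x∉  | no fx∉  = ⊥-elim (fx∉ (∉⇒f∈ x∈zs x∉))

  module _ {c : A → Bool} (c-flip : ∀ {x} → x ∈ zs → c (f x) ≡ not (c x))
           (f-onto : ∀ {z} → z ∈ zs → ∃[ x ] (x ∈ zs × f x ≡ z)) where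

    uncoloured++map↭ : uncoloured c zs ++ map f (uncoloured c zs) ↭ zs
    uncoloured++map↭ = unique∧same-elements⇒↭
      (Unique.++⁺ S! (Unique-map⁺-local (λ x∈ y∈ → f-injective (uncoloured⊆ c zs x∈) (uncoloured⊆ c zs y∈)) S!)
        disjoint)
      zs! ⊆ ⊇
      where
      S = uncoloured c zs
      S! : Unique S
      S! = uncoloured-unique c zs!
      disjoint : Disjoint S (map f S)
      disjoint (v∈ , v∈map) with ∈-map⁻ f v∈map
      ... | y , y∈ , refl with () ← trans (sym (uncoloured-false c zs v∈))
                                   (trans (c-flip (uncoloured⊆ c zs y∈)) (cong not (uncoloured-false c zs y∈)))
      ⊆ : ∀ {z} → z ∈ S ++ map f S → z ∈ zs
      ⊆ z∈ with ∈-++⁻ S z∈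
      ... | inj₁ z∈S = uncoloured⊆ c zs z∈S
      ... | inj₂ z∈map with ∈-map⁻ f z∈map
      ...   | y , y∈ , refl = f-closed (uncoloured⊆ c zs y∈)
      ⊇ : ∀ {z} → z ∈ zs → z ∈ S ++ map f S
      ⊇ {z} z∈ with c z Bool.≟ false
      ... | yes cz≡false = ∈-++⁺ˡ (∈-filter⁺ _ z∈ cz≡false)
      ... | no cz≢false with f-onto z∈
      ...   | y , y∈ , refl = ∈-++⁺ʳ S (∈-map⁺ f (∈-filter⁺ _ y∈
                (Bool.not-injective (trans (sym (c-flip y∈)) (Bool.¬-not cz≢false)))))

-- The non-zero residues modulo an odd n

∈nonzeroₙ⇒0< : ∀ {n x} .{{_ : NonZero n}} → x ∈ nonzeroₙ n → 0 < x
∈nonzeroₙ⇒0< {suc n} x∈ with _ , _ , refl ← ∈-applyUpTo⁻ suc x∈ = z<s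

∈nonzeroₙ⇒<n : ∀ {n x} .{{_ : NonZero n}} → x ∈ nonzeroₙ n → x < n
∈nonzeroₙ⇒<n {suc n} x∈ with _ , i<n , refl ← ∈-applyUpTo⁻ suc x∈ = s≤s i<n

bounds⇒∈nonzeroₙ : ∀ {n x} .{{_ : NonZero n}} → 0 < x → x < n → x ∈ nonzeroₙ n
bounds⇒∈nonzeroₙ {suc n} {suc i} _ (s≤s i<n) = ∈-applyUpTo⁺ suc i<n

module Residues (n : ℕ) .{{_ : NonZero n}} (n-odd : n % 2 ≡ 1) where
  open Congruence n public
  open import Relation.Binary.Reasoning.Setoid ≈-setoid

  N : List ℕ
  N = nonzeroₙ n

  N! : Unique N
  N! = Unique.applyUpTo⁺₁ suc (n ∸ 1) (λ i<j _ → <⇒≢ i<j ∘ suc-injective)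

  ≈0⇒≡0 : ∀ {x} → x < n → x ≈ 0 → x ≡ 0
  ≈0⇒≡0 x<n = ≈⇒≡ x<n (>-nonZero⁻¹ n)

  dbl : ℕ → ℕ
  dbl x = 2 * x % n

  neg : ℕ → ℕ
  neg x = n ∸ x

  module _ {x} (x∈N : x ∈ N) where
    private
      0<x = ∈nonzeroₙ⇒0< x∈N
      x<n = ∈nonzeroₙ⇒<n x∈N

    dbl∈N : dbl x ∈ N
    dbl∈N = bounds⇒∈nonzeroₙ (≤∧≢⇒< z≤n λ 0≡2x → <⇒≢ 0<x (sym (≈0⇒≡0 x<n
      (*-cancelˡ-≈-2 n-odd (≈-trans (≈-sym (m%M≈m (2 * x))) (≡⇒≈ (sym 0≡2x)))))))
      (m%n<n (2 * x) n)

    neg∈N : neg x ∈ N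
    neg∈N = bounds⇒∈nonzeroₙ (m<n⇒0<n∸m x<n) (∸-monoʳ-< 0<x (<⇒≤ x<n))

    neg-involutive : neg (neg x) ≡ x
    neg-involutive = m∸[m∸n]≡n (<⇒≤ x<n)

    ≈-neg⇒≡neg : ∀ {y} → y < n → y + x ≈ 0 → y ≡ neg x
    ≈-neg⇒≡neg {y} y<n y+x≈0 = ≈⇒≡ y<n (∸-monoʳ-< 0<x (<⇒≤ x<n)) (+-cancelʳ-≈ x (begin
      y + x        ≈⟨ y+x≈0 ⟩
      0            ≈⟨ m+k*M≈m 0 1 ⟨
      0 + 1 * n    ≡⟨ cong (0 +_) (*-identityˡ n) ⟩
      n            ≡⟨ m∸n+n≡m (<⇒≤ x<n) ⟨
      neg x + x    ∎))

    sub[x,2x]≡neg : subₙ n x (dbl x) ≡ neg x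
    sub[x,2x]≡neg = ≈-neg⇒≡neg (m%n<n _ n) (begin
      (x + (n ∸ dbl x)) % n + x   ≈⟨ +-cong (m%M≈m (x + (n ∸ dbl x))) ≈-refl ⟩
      x + (n ∸ dbl x) + x         ≡⟨ regroup x (n ∸ dbl x) ⟩
      2 * x + (n ∸ dbl x)         ≈⟨ +-cong (m%M≈m (2 * x)) ≈-refl ⟨
      dbl x + (n ∸ dbl x)         ≡⟨ m+[n∸m]≡n (<⇒≤ (m%n<n (2 * x) n)) ⟩
      n                           ≈⟨ ∣⇒≈0 ∣-refl ⟩
      0                           ∎)
      where
      regroup : ∀ x y → x + y + x ≡ 2 * x + y
      regroup = solve-∀

    sub[2x,x]≡x : subₙ n (dbl x) x ≡ x
    sub[2x,x]≡x = ≈⇒≡ (m%n<n _ n) x<n (+-cancelʳ-≈ x (begin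
      (dbl x + (n ∸ x)) % n + x   ≈⟨ +-cong (m%M≈m (dbl x + (n ∸ x))) ≈-refl ⟩
      dbl x + (n ∸ x) + x         ≡⟨ +-assoc (dbl x) (n ∸ x) x ⟩
      dbl x + (n ∸ x + x)         ≡⟨ cong (dbl x +_) (m∸n+n≡m (<⇒≤ x<n)) ⟩
      dbl x + n                   ≡⟨ cong (dbl x +_) (*-identityˡ n) ⟨
      dbl x + 1 * n               ≈⟨ m+k*M≈m (dbl x) 1 ⟩
      dbl x                       ≈⟨ m%M≈m (2 * x) ⟩
      2 * x                       ≡⟨ cong (x +_) (+-identityʳ x) ⟩
      x + x                       ∎))

  dbl-injective : ∀ {x y} → x ∈ N → y ∈ N → dbl x ≡ dbl y → x ≡ y
  dbl-injective {x} {y} x∈N y∈N 2x≡2y = ≈⇒≡ (∈nonzeroₙ⇒<n x∈N) (∈nonzeroₙ⇒<n y∈N)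
    (*-cancelˡ-≈-2 n-odd (≈-trans (≈-sym (m%M≈m (2 * x))) (≈-trans (≡⇒≈ 2x≡2y) (m%M≈m (2 * y)))))

  neg-injective : ∀ {x y} → x ∈ N → y ∈ N → neg x ≡ neg y → x ≡ y
  neg-injective x∈N y∈N -x≡-y = trans (sym (neg-involutive x∈N)) (trans (cong neg -x≡-y) (neg-involutive y∈N))

  dbl-onto : ∀ {z} → z ∈ N → ∃[ y ] (y ∈ N × dbl y ≡ z)
  dbl-onto {z} z∈N = y , y∈N , 2y≡z
    where
    ½ = suc (n / 2)
    y = ½ * z % n
    z<n = ∈nonzeroₙ⇒<n z∈N
    2y≡z : dbl y ≡ z
    2y≡z = ≈⇒≡ (m%n<n _ n) z<n (begin
      dbl y           ≈⟨ m%M≈m (2 * y) ⟩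
      2 * y           ≈⟨ *-congˡ 2 (m%M≈m (½ * z)) ⟩
      2 * (½ * z)     ≡⟨ regroup ½ z ⟩
      ½ * 2 * z       ≈⟨ *-cong ([1+M/2]*2≈1 n-odd) ≈-refl ⟩
      1 * z           ≡⟨ *-identityˡ z ⟩
      z               ∎)
      where
      regroup : ∀ h z → 2 * (h * z) ≡ h * 2 * z
      regroup = solve-∀
    y∈N : y ∈ N
    y∈N = bounds⇒∈nonzeroₙ (≤∧≢⇒< z≤n λ 0≡y → <⇒≢ (∈nonzeroₙ⇒0< z∈N)
      (trans (sym (m<n⇒m%n≡m (>-nonZero⁻¹ n))) (trans (cong dbl 0≡y) 2y≡z))) (m%n<n _ n)

  iterate-dbl≈ : ∀ t x → iterate dbl x t ≈ 2 ^ t * x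
  iterate-dbl≈ zero x = ≡⇒≈ (sym (+-identityʳ x))
  iterate-dbl≈ (suc t) x = begin
    iterate dbl (dbl x) t   ≈⟨ iterate-dbl≈ t (dbl x) ⟩
    2 ^ t * dbl x           ≈⟨ *-congˡ (2 ^ t) (m%M≈m (2 * x)) ⟩
    2 ^ t * (2 * x)         ≡⟨ regroup (2 ^ t) x ⟩
    2 * 2 ^ t * x           ∎
    where
    regroup : ∀ p x → p * (2 * x) ≡ 2 * p * x
    regroup = solve-∀

  add[x,2x]≈3x : ∀ x → addₙ n x (dbl x) ≈ 3 * x
  add[x,2x]≈3x x = begin
    (x + dbl x) % n   ≈⟨ m%M≈m (x + dbl x) ⟩
    x + dbl x         ≈⟨ +-congˡ x (m%M≈m (2 * x)) ⟩
    x + 2 * x         ≡⟨ triple x ⟩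
    3 * x             ∎
    where
    triple : ∀ x → x + 2 * x ≡ 3 * x
    triple = solve-∀

  iterate-dbl< : ∀ t {x} → x < n → iterate dbl x t < n
  iterate-dbl< zero x<n = x<n
  iterate-dbl< (suc t) {x} _ = iterate-dbl< t (m%n<n (2 * x) n)

-- From a strong cardioidal starter to C₂ ∖ {3}

module _ (h : A → A) where

  Cardioidal : A × A → Set
  Cardioidal (s , t) = t ≡ h s ⊎ s ≡ h t

  bases : ∀ {ps} → All Cardioidal ps → List A
  bases [] = []
  bases {(s , _) ∷ _} (inj₁ _ ∷ cs) = s ∷ bases cs
  bases {(_ , t) ∷ _} (inj₂ _ ∷ cs) = t ∷ bases cs

  concatMap-bases↭ : (k : A × A → B) → ∀ {ps} (cs : All Cardioidal ps) →
    concatMap (λ p → k p ∷ k (swap p) ∷ []) ps ↭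
    map (λ i → k (i , h i)) (bases cs) ++ map (λ i → k (h i , i)) (bases cs)
  concatMap-bases↭ k [] = ↭-refl
  concatMap-bases↭ k {(s , _) ∷ _} (inj₁ refl ∷ cs) =
    ↭-prep₂ (k (s , h s)) (k (h s , s)) (concatMap-bases↭ k cs)
  concatMap-bases↭ k {(_ , t) ∷ _} (inj₂ refl ∷ cs) =
    ↭-trans (↭-swap _ _ ↭-refl) (↭-prep₂ (k (t , h t)) (k (h t , t)) (concatMap-bases↭ k cs))

  All-bases : (Q : A × A → Set) → (∀ {p} → Q p → Q (swap p)) →
    ∀ {ps} (cs : All Cardioidal ps) → All Q ps → All (λ i → Q (i , h i)) (bases cs)
  All-bases Q Q-swap [] [] = []
  All-bases Q Q-swap (inj₁ refl ∷ cs) (q ∷ qs) = q ∷ All-bases Q Q-swap cs qs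
  All-bases Q Q-swap (inj₂ refl ∷ cs) (q ∷ qs) = Q-swap q ∷ All-bases Q Q-swap cs qs

starter⇒split : ∀ n .{{_ : NonZero n}} (n-odd : n % 2 ≡ 1) → StrongCardioidalStarterExists n →
  let open Residues n n-odd in
  ∃[ I ] ((I ++ map dbl I ↭ N) × (I ++ map neg I ↭ N) × All (λ i → addₙ n i (dbl i) ≢ 0) I)
starter⇒split n n-odd (ps , ((elements↭N , differences↭N) , sums≢0 , _) , cardioidal) =
  I , split-dbl , split-neg , All-bases dbl _ (λ {(s , t)} ne → ne ∘ trans (cong (_% n) (+-comm s t))) cardioidal
    sums≢0
  where
  -- The pattern-matching lambdas of IsStarter and IsCardioidal are definitionally the
  -- projection forms that concatMap-bases↭ and Cardioidal dbl are stated with.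
  open Residues n n-odd
  open PermutationReasoning
  I = bases dbl cardioidal
  split-dbl : I ++ map dbl I ↭ N
  split-dbl = begin
    I ++ map dbl I                ≡⟨ cong (_++ map dbl I) (map-id I) ⟨
    map id I ++ map dbl I         ↭⟨ concatMap-bases↭ dbl proj₁ cardioidal ⟨
    _                             ↭⟨ elements↭N ⟩
    N                             ∎
  I⊆N : ∀ {i} → i ∈ I → i ∈ N
  I⊆N i∈I = ∈-resp-↭ split-dbl (∈-++⁺ˡ i∈I)
  split-neg : I ++ map neg I ↭ N
  split-neg = begin
    I ++ map neg I                ↭⟨ ++-comm I (map neg I) ⟩
    map neg I ++ I                ≡⟨ cong₂ _++_ (map-cong-local (All.tabulate (sub[x,2x]≡neg ∘ I⊆N)))
                                                (map-id-local (All.tabulate (sub[2x,x]≡x ∘ I⊆N))) ⟨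
    map (λ i → subₙ n i (dbl i)) I ++ map (λ i → subₙ n (dbl i) i) I
                                  ↭⟨ concatMap-bases↭ dbl (λ p → subₙ n (proj₁ p) (proj₂ p)) cardioidal ⟨
    _                             ↭⟨ differences↭N ⟩
    N                             ∎

module Forward (n : ℕ) .{{_ : NonZero n}} (n-odd : n % 2 ≡ 1) {I : List ℕ}
               (split-dbl : I ++ map (Residues.dbl n n-odd) I ↭ nonzeroₙ n)
               (split-neg : I ++ map (Residues.neg n n-odd) I ↭ nonzeroₙ n)
               (sums≢0 : All (λ i → addₙ n i (Residues.dbl n n-odd i) ≢ 0) I) where
  open Residues n n-odd
  open import Data.List.Membership.DecPropositional _≟_ using (_∈?_)
  open import Relation.Binary.Reasoning.Setoid ≈-setoid

  colour : ℕ → Bool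
  colour x = does (x ∈? I)

  colour-dbl : ∀ {x} → x ∈ N → colour (dbl x) ≡ not (colour x)
  colour-dbl = Halves.membership-flips N! dbl∈N dbl-injective _≟_ {I} split-dbl

  colour-neg : ∀ {x} → x ∈ N → colour (neg x) ≡ not (colour x)
  colour-neg = Halves.membership-flips N! neg∈N neg-injective _≟_ {I} split-neg

  module _ {p m} .{{_ : NonZero p}} (p-prime : Prime p) (n≡m*p : n ≡ m * p) where

    m∈N : m ∈ N
    m∈N = bounds⇒∈nonzeroₙ (>-nonZero⁻¹ m) (subst (m <_) (sym n≡m*p) (m<m*n m p (prime⇒1< p-prime)))
      where
      instance
        m≢0 : NonZero m
        m≢0 = m*n≢0⇒m≢0 m {{≢-nonZero (λ m*p≡0 → ≢-nonZero⁻¹ n (trans n≡m*p m*p≡0))}}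

    private
      m<n = ∈nonzeroₙ⇒<n m∈N

    iterate-dbl-fixes : ∀ t → 2 ^ t % p ≡ 1 → iterate dbl m t ≡ m
    iterate-dbl-fixes t 2^t%p≡1 = ≈⇒≡ (iterate-dbl< t m<n) m<n (begin
      iterate dbl m t            ≈⟨ iterate-dbl≈ t m ⟩
      2 ^ t * m                  ≡⟨ cong (_* m) (m≡m%n+[m/n]*n (2 ^ t) p) ⟩
      (2 ^ t % p + r * p) * m    ≡⟨ cong (λ e → (e + r * p) * m) 2^t%p≡1 ⟩
      (1 + r * p) * m            ≡⟨ regroup m r p ⟩
      m + r * (m * p)            ≡⟨ cong (λ e → m + r * e) n≡m*p ⟨
      m + r * n                  ≈⟨ m+k*M≈m m r ⟩
      m                          ∎)
      where
      r = 2 ^ t / p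
      regroup : ∀ m r p → (1 + r * p) * m ≡ m + r * (m * p)
      regroup = solve-∀

    iterate-dbl-negates : ∀ t → p ∣ 2 ^ t + 1 → iterate dbl m t ≡ neg m
    iterate-dbl-negates t (divides s 2^t+1≡s*p) = ≈-neg⇒≡neg m∈N (iterate-dbl< t m<n) (begin
      iterate dbl m t + m        ≈⟨ +-cong (iterate-dbl≈ t m) ≈-refl ⟩
      2 ^ t * m + m              ≡⟨ regroup (2 ^ t) m ⟩
      (2 ^ t + 1) * m            ≡⟨ cong (_* m) 2^t+1≡s*p ⟩
      s * p * m                  ≡⟨ trans (*-assoc s p m) (cong (s *_) (*-comm p m)) ⟩
      s * (m * p)                ≡⟨ cong (s *_) n≡m*p ⟨
      0 + s * n                  ≈⟨ m+k*M≈m 0 s ⟩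
      0                          ∎)
      where
      regroup : ∀ P m → P * m + m ≡ (P + 1) * m
      regroup = solve-∀

    order-of-2-even : ∀ {k} → IsOrderOf2 p k → ∃[ l ] k ≡ l + l
    order-of-2-even {k} (_ , 2^k%p≡1 , _) =
      colour-fixed⇒even dbl∈N colour colour-dbl {k} m∈N (cong colour (iterate-dbl-fixes k 2^k%p≡1))

    half-order-of-2-odd : ∀ {l} → IsOrderOf2 p (l + l) → Odd l
    half-order-of-2-odd {l} order = colour-flipped⇒odd dbl∈N colour colour-dbl {l} m∈N
      (trans (cong colour (iterate-dbl-negates l (order-of-2-even⇒∣2^half+1 p-prime {l} order))) (colour-neg m∈N))

    order-of-2≡2[mod4] : ∀ {k} → IsOrderOf2 p k → k % 4 ≡ 2
    order-of-2≡2[mod4] order with l , refl ← order-of-2-even order = [odd+odd]%4≡2 (half-order-of-2-odd {l} order)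

  prime∣n⇒C₂ : ∀ {p} → Prime p → p ∣ n → C₂ p
  prime∣n⇒C₂ {zero} p-prime _ = p-prime
  prime∣n⇒C₂ {p@(suc _)} p-prime p∣n@(divides m n≡m*p)
    with k , order ← order-of-2-exists (prime⇒1< p-prime) (∣-preserves-odd p∣n n-odd) =
    p-prime , ∣-preserves-odd p∣n n-odd , k , order , order-of-2≡2[mod4] {m = m} p-prime n≡m*p order

  3∣n⇒3-torsion∈I : 3 ∣ n → ∃[ x ] (x ∈ I × 3 * x ≈ 0)
  3∣n⇒3-torsion∈I (divides m n≡m*3) = pick (m ∈? I)
    where
    3m≈0 : 3 * m ≈ 0
    3m≈0 = ∣⇒≈0 (divides 1 (trans (*-comm 3 m) (trans (sym n≡m*3) (sym (*-identityˡ n)))))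
    swap-factors : ∀ m → 3 * (2 * m) ≡ 2 * (3 * m)
    swap-factors = solve-∀
    pick : Dec (m ∈ I) → ∃[ x ] (x ∈ I × 3 * x ≈ 0)
    pick (yes m∈I) = m , m∈I , 3m≈0
    pick (no m∉I) = dbl m , Halves.∉⇒f∈ N! dbl∈N dbl-injective _≟_ split-dbl (m∈N prime[3] n≡m*3) m∉I ,
      (begin
        3 * dbl m        ≈⟨ *-congˡ 3 (m%M≈m (2 * m)) ⟩
        3 * (2 * m)      ≡⟨ swap-factors m ⟩
        2 * (3 * m)      ≈⟨ *-congˡ 2 3m≈0 ⟩
        0                ∎)

  3∤n : ¬ 3 ∣ n
  3∤n 3∣n with x , x∈I , 3x≈0 ← 3∣n⇒3-torsion∈I 3∣n =
    All.lookup sums≢0 x∈I (≈0⇒≡0 (m%n<n _ n) (≈-trans (add[x,2x]≈3x x) 3x≈0))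

  prime∣n⇒C₂∖3 : ∀ {p} → Prime p → p ∣ n → C₂∖3 p
  prime∣n⇒C₂∖3 p-prime p∣n = prime∣n⇒C₂ p-prime p∣n , λ { refl → 3∤n p∣n }

-- From C₂ ∖ {3} to a strong cardioidal starter

module Backward (n : ℕ) .{{_ : NonZero n}} (n-odd : n % 2 ≡ 1) {j : ℕ} (j-odd : Odd j)
                (n∣2^j+1 : n ∣ 2 ^ j + 1) (3∤n : ¬ 3 ∣ n) where
  open Residues n n-odd

  private
    h = n / 2

    n≡1+h+h : n ≡ suc (h + h)
    n≡1+h+h = trans (m≡m%n+[m/n]*n n 2) (trans (cong (_+ h * 2) n-odd) (cong suc (h*2≡h+h h)))
      where
      h*2≡h+h : ∀ h → h * 2 ≡ h + h
      h*2≡h+h = solve-∀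

  upper : ℕ → Bool
  upper x = h <ᵇ x

  upper-neg : ∀ {x} → x ∈ N → upper (neg x) ≡ not (upper x)
  upper-neg {x} x∈N with h <ᵇ x | <ᵇ-reflects-< h x | h <ᵇ neg x | <ᵇ-reflects-< h (neg x)
  ... | true | ofʸ h<x | true | ofʸ h<-x = ⊥-elim (<-irrefl refl (begin-strict
    n                 ≡⟨ n≡1+h+h ⟩
    suc (h + h)       ≤⟨ +-monoʳ-< h h<-x ⟩
    h + neg x         <⟨ +-monoˡ-< (neg x) h<x ⟩
    x + neg x         ≡⟨ m+[n∸m]≡n (<⇒≤ (∈nonzeroₙ⇒<n x∈N)) ⟩
    n                 ∎))
    where open ≤-Reasoning
  ... | true | _ | false | _ = refl
  ... | false | _ | true | _ = refl
  ... | false | ofⁿ h≮x | false | ofⁿ h≮-x = ⊥-elim (<-irrefl refl (begin-strict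
    n                 ≡⟨ m+[n∸m]≡n (<⇒≤ (∈nonzeroₙ⇒<n x∈N)) ⟨
    x + neg x         ≤⟨ +-mono-≤ (≮⇒≥ h≮x) (≮⇒≥ h≮-x) ⟩
    h + h             <⟨ n<1+n (h + h) ⟩
    suc (h + h)       ≡⟨ n≡1+h+h ⟨
    n                 ∎))
    where open ≤-Reasoning

  upper-parity : ℕ → ℕ → Bool
  upper-parity x zero = false
  upper-parity x (suc t) = upper x xor upper-parity (dbl x) t

  upper-parity-suc : ∀ t x → upper-parity x (suc t) ≡ upper-parity x t xor upper (iterate dbl x t)
  upper-parity-suc zero x = Bool.xor-identityʳ (upper x)
  upper-parity-suc (suc t) x = trans (cong (upper x xor_) (upper-parity-suc t (dbl x)))
    (sym (Bool.xor-assoc (upper x) (upper-parity (dbl x) t) (upper (iterate dbl (dbl x) t))))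

  iterate-dbl-j≡neg : ∀ {x} → x ∈ N → iterate dbl x j ≡ neg x
  iterate-dbl-j≡neg {x} x∈N =
    ≈-neg⇒≡neg x∈N (iterate-dbl< j (∈nonzeroₙ⇒<n x∈N)) (begin
      iterate dbl x j + x      ≈⟨ +-cong (iterate-dbl≈ j x) ≈-refl ⟩
      2 ^ j * x + x            ≡⟨ regroup (2 ^ j) x ⟩
      (2 ^ j + 1) * x          ≡⟨ cong (_* x) 2^j+1≡s*n ⟩
      s * n * x                ≡⟨ regroup-quotient s n x ⟩
      0 + s * x * n            ≈⟨ m+k*M≈m 0 (s * x) ⟩
      0                        ∎)
    where
    open _∣_ n∣2^j+1 renaming (quotient to s; equality to 2^j+1≡s*n)
    open import Relation.Binary.Reasoning.Setoid ≈-setoid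
    regroup : ∀ P x → P * x + x ≡ (P + 1) * x
    regroup = solve-∀
    regroup-quotient : ∀ s n x → s * n * x ≡ 0 + s * x * n
    regroup-quotient = solve-∀

  colour : ℕ → Bool
  colour x = upper-parity x j

  colour-dbl : ∀ {x} → x ∈ N → colour (dbl x) ≡ not (colour x)
  colour-dbl {x} x∈N = xor-cancel (upper x) (colour (dbl x)) (colour x) (begin
    upper x xor colour (dbl x)            ≡⟨ upper-parity-suc j x ⟩
    colour x xor upper (iterate dbl x j)  ≡⟨ cong (λ y → colour x xor upper y) (iterate-dbl-j≡neg x∈N) ⟩
    colour x xor upper (neg x)            ≡⟨ cong (colour x xor_) (upper-neg x∈N) ⟩
    colour x xor not (upper x)            ∎)
    where
    open ≡-Reasoning
    xor-cancel : ∀ a u v → a xor u ≡ v xor not a → u ≡ not v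
    xor-cancel false false true  _ = refl
    xor-cancel false true  false _ = refl
    xor-cancel true  false true  _ = refl
    xor-cancel true  true  false _ = refl
    xor-cancel false false false ()
    xor-cancel false true  true  ()
    xor-cancel true  false false ()
    xor-cancel true  true  true  ()

  colour-neg : ∀ {x} → x ∈ N → colour (neg x) ≡ not (colour x)
  colour-neg x∈N =
    trans (cong colour (sym (iterate-dbl-j≡neg x∈N))) (colour-iterate-odd dbl∈N colour colour-dbl j-odd x∈N)

  neg-onto : ∀ {z} → z ∈ N → ∃[ x ] (x ∈ N × neg x ≡ z)
  neg-onto z∈N = _ , neg∈N z∈N , neg-involutive z∈N

  S : List ℕ
  S = uncoloured colour N

  S++2S↭N : S ++ map dbl S ↭ N
  S++2S↭N = Halves.uncoloured++map↭ N! dbl∈N dbl-injective colour-dbl dbl-onto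

  S++-S↭N : S ++ map neg S ↭ N
  S++-S↭N = Halves.uncoloured++map↭ N! neg∈N neg-injective colour-neg neg-onto

  3-cancel : ∀ {x y} → 3 * x ≈ 3 * y → x ≈ y
  3-cancel = *-cancelˡ-≈-coprime (prime∤⇒coprime prime[3] 3∤n)

  sum≢0 : ∀ {x} → x ∈ N → addₙ n x (dbl x) ≢ 0
  sum≢0 {x} x∈N sum≡0 = <⇒≢ 0<x (sym (≈0⇒≡0 x<n (3-cancel (≈-trans (≈-sym (add[x,2x]≈3x x)) (≡⇒≈ sum≡0)))))
    where
    0<x = ∈nonzeroₙ⇒0< x∈N
    x<n = ∈nonzeroₙ⇒<n x∈N

  sum-injective : ∀ {x y} → x ∈ N → y ∈ N → addₙ n x (dbl x) ≡ addₙ n y (dbl y) → x ≡ y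
  sum-injective {x} {y} x∈N y∈N sums≡ = ≈⇒≡ (∈nonzeroₙ⇒<n x∈N) (∈nonzeroₙ⇒<n y∈N)
    (3-cancel (≈-trans (≈-sym (add[x,2x]≈3x x)) (≈-trans (≡⇒≈ sums≡) (add[x,2x]≈3x y))))

  pair : ℕ → ℕ × ℕ
  pair x = x , dbl x

  S⊆N : ∀ {x} → x ∈ S → x ∈ N
  S⊆N = uncoloured⊆ colour N

  strong-cardioidal-starter : StrongCardioidalStarterExists n
  strong-cardioidal-starter = map pair S , ((elements↭N , differences↭N) , sums≢0 , sums-unique) , cardioidal
    where
    open PermutationReasoning
    elements↭N : concatMap (λ p → proj₁ p ∷ proj₂ p ∷ []) (map pair S) ↭ N
    elements↭N = begin
      concatMap (λ p → proj₁ p ∷ proj₂ p ∷ []) (map pair S)  ≡⟨ concatMap-map _ pair S ⟩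
      concatMap (λ x → x ∷ dbl x ∷ []) S                     ↭⟨ concatMap-pairs↭ id dbl S ⟩
      map id S ++ map dbl S                                  ≡⟨ cong (_++ map dbl S) (map-id S) ⟩
      S ++ map dbl S                                         ↭⟨ S++2S↭N ⟩
      N                                                      ∎
    differences↭N : concatMap (λ p → subₙ n (proj₁ p) (proj₂ p) ∷ subₙ n (proj₂ p) (proj₁ p) ∷ []) (map pair S) ↭ N
    differences↭N = begin
      concatMap (λ p → subₙ n (proj₁ p) (proj₂ p) ∷ subₙ n (proj₂ p) (proj₁ p) ∷ []) (map pair S)
        ≡⟨ concatMap-map _ pair S ⟩
      concatMap (λ x → subₙ n x (dbl x) ∷ subₙ n (dbl x) x ∷ []) S
        ↭⟨ concatMap-pairs↭ (λ x → subₙ n x (dbl x)) (λ x → subₙ n (dbl x) x) S ⟩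
      map (λ x → subₙ n x (dbl x)) S ++ map (λ x → subₙ n (dbl x) x) S
        ≡⟨ cong₂ _++_ (map-cong-local (All.tabulate (sub[x,2x]≡neg ∘ S⊆N)))
                      (map-id-local (All.tabulate (sub[2x,x]≡x ∘ S⊆N))) ⟩
      map neg S ++ S
        ↭⟨ ++-comm (map neg S) S ⟩
      S ++ map neg S
        ↭⟨ S++-S↭N ⟩
      N ∎
    sums≢0 : All (λ p → addₙ n (proj₁ p) (proj₂ p) ≢ 0) (map pair S)
    sums≢0 = All.map⁺ (All.tabulate (sum≢0 ∘ S⊆N))
    sums-unique : Unique (map (λ p → addₙ n (proj₁ p) (proj₂ p)) (map pair S))
    sums-unique = subst Unique (map-∘ S)
      (Unique-map⁺-local (λ x∈ y∈ → sum-injective (S⊆N x∈) (S⊆N y∈)) (uncoloured-unique colour N!))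
    cardioidal : All (λ p → proj₂ p ≡ 2 * proj₁ p % n ⊎ proj₁ p ≡ 2 * proj₂ p % n) (map pair S)
    cardioidal = All.map⁺ (All.universal (λ _ → inj₁ refl) S)

theorem6 : (n : ℕ) .{{_ : NonZero n}} → 3 ≤ n → n % 2 ≡ 1 →
    (StrongCardioidalStarterExists n ⇔ Closure C₂∖3 n)
theorem6 n 3≤n n-odd = mk⇔ starter⇒closure closure⇒starter
  where
  starter⇒closure : StrongCardioidalStarterExists n → Closure C₂∖3 n
  starter⇒closure starter with I , split-dbl , split-neg , sums≢0 ← starter⇒split n n-odd starter =
    prime-divisors⇒Closure n (≤-trans (s≤s (s≤s z≤n)) 3≤n)
      (Forward.prime∣n⇒C₂∖3 n n-odd split-dbl split-neg sums≢0)

  closure⇒starter : Closure C₂∖3 n → StrongCardioidalStarterExists n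
  closure⇒starter closure with j , j-odd , n∣2^j+1 ← closure⇒∣2^odd+1 closure =
    Backward.strong-cardioidal-starter n n-odd j-odd n∣2^j+1 (closure⇒3∤ closure)
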